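{- Fix an integer $d\ge1$. There is a constant $C_d$ such that for every directed graph $G$ on $N$ vertices in which every vertex has in-degree at most $d$ and out-degree at most $d$, the cubic graph produced from $G$ by the conversion described in the context has at most $C_d N$ vertices and at most $C_d N$ edges; i.e. restricted to such instances the conversion to cubic HCP is linearly-growing.
   Context: Directed graphs have no loops and no two arcs with the same tail and head. The conversion has three steps. (1) Directed-to-undirected: replace each vertex $v$ by three vertices $a_v,b_v,c_v$ with edges $\{a_v,b_v\},\{b_v,c_v\}$, and for each arc $(u,v)$ add the edge $\{c_u,a_v\}$. (2) While some vertex has degree $s\ge4$, replace it by an $s$-gate: delete it and add a copy of the $s$-gate, joining its former $s$ neighbours bijectively to the $s$ attachment vertices. Here, for $s\ge4$, the $s$-gate has vertex set $\{1,\dots,10\}\cup\{b_1,\dots,b_{2s-7}\}$ and edges $\{1,3\},\{1,8\},\{2,3\},\{2,5\},\{3,4\},\{4,5\},\{4,6\},\{6,7\},\{7,8\},\{7,10\},\{8,9\},\{9,10\}$, $\{5,b_1\}$, $\{10,b_{2s-7}\}$, $\{b_i,b_{i+1}\}$ ($1\le i\le 2s-8$), $\{1,b_{2j}\}$ ($1\le j\le s-4$), with attachment vertices $1,2,9,b_1,b_3,\dots,b_{2s-7}$. (3) Sub-cubic-to-cubic: if some vertex has degree 1, output the Petersen graph; otherwise replace each degree-2 vertex $v$ with neighbours $u,w$ by a diamond, i.e. four new vertices $x,y,z,t$ with edges $\{x,y\},\{x,z\},\{y,z\},\{y,t\},\{z,t\}$ together with $\{u,x\},\{t,w\}$. -}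

module Defs where

open import Data.Bool using (Bool; true; false; if_then_else_; _∨_)
open import Data.Nat using (ℕ; zero; suc; _+_; _*_; _∸_; _≤_; _<_; _≡ᵇ_; _<ᵇ_)
open import Data.Fin using (Fin; toℕ)
open import Data.Product using (_×_; _,_; Σ; ∃-syntax)
open import Data.List using (List; []; _∷_; _++_; map; concatMap; length; applyUpTo; allFin; zipWith)
open import Data.List.Relation.Binary.Permutation.Propositional using (_↭_)
open import Relation.Binary.PropositionalEquality using (_≡_; _≢_)

-- Representing arcs by a
-- Boolean relation automatically forbids two arcs with the same tail and
-- head; loops are excluded by the predicate Loopless.

Digraph : ℕ → Set
Digraph N = Fin N → Fin N → Bool

Loopless : ∀ {N} → Digraph N → Set
Loopless {N} G = ∀ (v : Fin N) → G v v ≡ false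

count : ∀ {N} → (Fin N → Bool) → ℕ
count {N} p = length (concatMap (λ u → if p u then u ∷ [] else []) (allFin N))

indeg : ∀ {N} → Digraph N → Fin N → ℕ
indeg G v = count (λ u → G u v)

outdeg : ∀ {N} → Digraph N → Fin N → ℕ
outdeg G v = count (λ w → G v w)

-- Finite undirected graphs: vertex set {0, …, size - 1} (labels in ℕ),
-- edge set given as a list of pairs, each pair (x , y) standing for the
-- unordered edge {x , y}.  All constructions below produce simple graphs
-- (no loops, no repeated edges), so the number of edges is the length of
-- the list.

record UGraph : Set where
  constructor mkU
  field
    size  : ℕ
    edges : List (ℕ × ℕ)
open UGraph public

numEdges : UGraph → ℕ
numEdges g = length (edges g)

nbrs : UGraph → ℕ → List ℕ
nbrs g v = concatMap f (edges g)
  where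
  f : ℕ × ℕ → List ℕ
  f (x , y) = if x ≡ᵇ v then y ∷ [] else (if y ≡ᵇ v then x ∷ [] else [])

degree : UGraph → ℕ → ℕ
degree g v = length (nbrs g v)

awayFrom : UGraph → ℕ → List (ℕ × ℕ)
awayFrom g v = concatMap f (edges g)
  where
  f : ℕ × ℕ → List (ℕ × ℕ)
  f (x , y) = if (x ≡ᵇ v) ∨ (y ≡ᵇ v) then [] else (x , y) ∷ []

-- relabelling of the remaining vertices after deleting vertex v
relabel : ℕ → ℕ → ℕ
relabel v x = if x <ᵇ v then x else x ∸ 1

-- Delete vertex v of g and insert a gadget on k new vertices (gadget
-- labels 0 … k-1, edges gadgetE), joining the former neighbours of v
-- (in the order of nbrs g v) to the gadget vertices listed in att.
substitute : (g : UGraph) (v k : ℕ) (gadgetE : List (ℕ × ℕ)) (att : List ℕ) → UGraph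
substitute g v k gadgetE att =
  mkU (base + k)
      (map (λ { (x , y) → relabel v x , relabel v y }) (awayFrom g v)
       ++ map (λ { (x , y) → base + x , base + y }) gadgetE
       ++ zipWith (λ u a → relabel v u , base + a) (nbrs g v) att)
  where
  base : ℕ
  base = size g ∸ 1

aV bV cV : ℕ → ℕ
aV v = 3 * v
bV v = 3 * v + 1
cV v = 3 * v + 2

dirToUndir : ∀ {N} → Digraph N → UGraph
dirToUndir {N} G =
  mkU (3 * N)
      (concatMap (λ v → (aV (toℕ v) , bV (toℕ v)) ∷ (bV (toℕ v) , cV (toℕ v)) ∷ []) (allFin N)
       ++ concatMap (λ u → concatMap (λ v → if G u v then (cV (toℕ u) , aV (toℕ v)) ∷ [] else [])
                                     (allFin N))
                    (allFin N))

-- Step (2): the s-gate (s ≥ 4).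
-- Gate vertex i ∈ {1,…,10} has gadget label i ∸ 1;  b_k has label 9 + k.

gateB : ℕ → ℕ
gateB k = 9 + k

gateM : ℕ → ℕ
gateM s = 2 * s ∸ 7

gateSize : ℕ → ℕ
gateSize s = 10 + gateM s

gateEdges : ℕ → List (ℕ × ℕ)
gateEdges s =
  (0 , 2) ∷ (0 , 7) ∷ (1 , 2) ∷ (1 , 4) ∷ (2 , 3) ∷ (3 , 4) ∷ (3 , 5) ∷
  (5 , 6) ∷ (6 , 7) ∷ (6 , 9) ∷ (7 , 8) ∷ (8 , 9) ∷
  (4 , gateB 1) ∷ (9 , gateB (gateM s)) ∷ []
  ++ applyUpTo (λ i → gateB (suc i) , gateB (suc (suc i))) (gateM s ∸ 1)   -- {b_i , b_{i+1}}, 1 ≤ i ≤ 2s-8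
  ++ applyUpTo (λ j → 0 , gateB (2 * suc j)) (s ∸ 4)                      -- {1 , b_{2j}},   1 ≤ j ≤ s-4

-- attachment vertices 1, 2, 9, b_1, b_3, …, b_{2s-7}
gateAttach : ℕ → List ℕ
gateAttach s = 0 ∷ 1 ∷ 8 ∷ applyUpTo (λ i → gateB (suc (2 * i))) (s ∸ 3)

-- one gate replacement: replace vertex v (of degree s) by an s-gate,
-- the bijection between neighbours and attachment vertices being given
-- by an arbitrary reordering att of the attachment vertices.
gateReplace : (g : UGraph) (v : ℕ) (att : List ℕ) → UGraph
gateReplace g v att = substitute g v (gateSize (degree g v)) (gateEdges (degree g v)) att

-- Gated g h : h is a possible result of running step (2) on g
-- (any order of choosing the vertices, any bijections).
data Gated : UGraph → UGraph → Set where
  gdone : ∀ {g} → (∀ v → v < size g → degree g v ≤ 3) → Gated g g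
  gstep : ∀ {g h} (v : ℕ) → v < size g → 4 ≤ degree g v →
          (att : List ℕ) → att ↭ gateAttach (degree g v) →
          Gated (gateReplace g v att) h → Gated g h

petersen : UGraph
petersen = mkU 10
  ((0 , 1) ∷ (1 , 2) ∷ (2 , 3) ∷ (3 , 4) ∷ (4 , 0) ∷
   (0 , 5) ∷ (1 , 6) ∷ (2 , 7) ∷ (3 , 8) ∷ (4 , 9) ∷
   (5 , 7) ∷ (7 , 9) ∷ (9 , 6) ∷ (6 , 8) ∷ (8 , 5) ∷ [])

-- diamond on x = 0, y = 1, z = 2, t = 3; neighbours u, w of v are joined
-- to x and t respectively.
diamond : UGraph → ℕ → UGraph
diamond g v = substitute g v 4
  ((0 , 1) ∷ (0 , 2) ∷ (1 , 2) ∷ (1 , 3) ∷ (2 , 3) ∷ [])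
  (0 ∷ 3 ∷ [])

-- replacing every degree-2 vertex by a diamond (done one vertex at a time;
-- diamond vertices have degree 3 and other degrees are unchanged)
data Diamonds : UGraph → UGraph → Set where
  ddone : ∀ {g} → (∀ v → v < size g → degree g v ≢ 2) → Diamonds g g
  dstep : ∀ {g h} (v : ℕ) → v < size g → degree g v ≡ 2 →
          Diamonds (diamond g v) h → Diamonds g h

data Cubify : UGraph → UGraph → Set where
  toPetersen : ∀ {g} (v : ℕ) → v < size g → degree g v ≡ 1 → Cubify g petersen
  toDiamonds : ∀ {g h} → (∀ v → v < size g → degree g v ≢ 1) →
               Diamonds g h → Cubify g h

Converts : ∀ {N} → Digraph N → UGraph → Set
Converts G H = ∃[ g ] (Gated (dirToUndir G) g × Cubify g H)

-- Give a graph the cost |V| + |E| + Σ_v c(deg v), where c(2) = 8, c(1) = c(3) = 0 and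
-- c(s) grows quadratically for s ≥ 4. Gating a vertex of degree s ≥ 4 never raises the cost:
-- of the new vertices only vertex 1 of the gate has degree above 3, namely s - 1, and
-- c(s) - c(s - 1) = O(s) pays for the O(s) new vertices and edges. Replacing a degree-2 vertex
-- by a diamond is paid for by c(2). The graph of step (1) has 3N vertices, at most (2 + d)N
-- edges and degrees at most d + 1, so its cost, and hence the size of the output, is O_d(N);
-- the Petersen graph only arises when N ≥ 1 and is absorbed into the constant.
module Submission where

open import Defs
open import Data.Bool using (Bool; true; false; if_then_else_; T)
open import Data.Empty using (⊥-elim)
open import Data.Fin as Fin using (Fin; toℕ)
open import Data.Fin.Properties using (toℕ<n)
open import Data.List using (List; []; _∷_; _++_; map; concatMap; length; applyUpTo; allFin; zipWith; tabulate)
open import Data.List.Properties using (length-++; length-map; length-applyUpTo; length-zipWith)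
open import Data.List.Relation.Unary.All as All using (All; []; _∷_)
open import Data.List.Relation.Unary.All.Properties using (++⁺; applyUpTo⁺₁)
open import Data.List.Relation.Binary.Permutation.Propositional as ↭ using (_↭_)
open import Data.List.Relation.Binary.Permutation.Propositional.Properties using (All-resp-↭; ↭-length)
open import Data.Nat using (ℕ; zero; suc; _+_; _*_; _∸_; _≤_; _<_; _≡ᵇ_; _<ᵇ_; _≤ᵇ_; _⊓_; z≤n; s≤s)
open import Data.Nat.Properties
open import Algebra.Properties.CommutativeSemigroup +-commutativeSemigroup using (interchange; x∙yz≈y∙xz)
open import Data.Nat.Solver using (module +-*-Solver)
open import Data.Product using (_×_; _,_; proj₁; proj₂; map₂; ∃-syntax)
open import Data.Sum as Sum using (_⊎_; inj₁; inj₂)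
open import Data.Unit using (tt)
open import Function using (_∘_; case_of_)
open import Relation.Binary.PropositionalEquality
open +-*-Solver

-- Finite sums

sumMap : {A : Set} → (A → ℕ) → List A → ℕ
sumMap f [] = 0
sumMap f (x ∷ xs) = f x + sumMap f xs

sumMap-++ : ∀ {A : Set} (f : A → ℕ) xs ys → sumMap f (xs ++ ys) ≡ sumMap f xs + sumMap f ys
sumMap-++ f [] ys = refl
sumMap-++ f (x ∷ xs) ys = trans (cong (f x +_) (sumMap-++ f xs ys)) (sym (+-assoc (f x) _ _))

sumMap-cong : ∀ {A : Set} {f g : A → ℕ} xs → (∀ x → f x ≡ g x) → sumMap f xs ≡ sumMap g xs
sumMap-cong [] e = refl
sumMap-cong (x ∷ xs) e = cong₂ _+_ (e x) (sumMap-cong xs e)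

sumMap-mono : ∀ {A : Set} {f g : A → ℕ} xs → (∀ x → f x ≤ g x) → sumMap f xs ≤ sumMap g xs
sumMap-mono [] e = z≤n
sumMap-mono (x ∷ xs) e = +-mono-≤ (e x) (sumMap-mono xs e)

sumMap-+ : ∀ {A : Set} (f g : A → ℕ) xs → sumMap (λ x → f x + g x) xs ≡ sumMap f xs + sumMap g xs
sumMap-+ f g [] = refl
sumMap-+ f g (x ∷ xs) = trans (cong (f x + g x +_) (sumMap-+ f g xs)) (interchange (f x) (g x) _ _)

sumMap-*ˡ : ∀ {A : Set} c (f : A → ℕ) xs → sumMap (λ x → c * f x) xs ≡ c * sumMap f xs
sumMap-*ˡ c f [] = sym (*-zeroʳ c)
sumMap-*ˡ c f (x ∷ xs) = trans (cong (c * f x +_) (sumMap-*ˡ c f xs)) (sym (*-distribˡ-+ c (f x) _))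

sumMap-*ʳ : ∀ {A : Set} c (f : A → ℕ) xs → sumMap (λ x → f x * c) xs ≡ sumMap f xs * c
sumMap-*ʳ c f [] = refl
sumMap-*ʳ c f (x ∷ xs) = trans (cong (f x * c +_) (sumMap-*ʳ c f xs)) (sym (*-distribʳ-+ c (f x) _))

sumMap-zero : ∀ {A : Set} (xs : List A) → sumMap (λ _ → 0) xs ≡ 0
sumMap-zero [] = refl
sumMap-zero (x ∷ xs) = sumMap-zero xs

sumMap-comm : ∀ {A B : Set} (h : A → B → ℕ) xs ys →
  sumMap (λ x → sumMap (h x) ys) xs ≡ sumMap (λ y → sumMap (λ x → h x y) xs) ys
sumMap-comm h [] ys = sym (sumMap-zero ys)
sumMap-comm h (x ∷ xs) ys = trans (cong (sumMap (h x) ys +_) (sumMap-comm h xs ys))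
                                  (sym (sumMap-+ (h x) (λ y → sumMap (λ x → h x y) xs) ys))

sumMap-concatMap : ∀ {A B : Set} (f : B → ℕ) (g : A → List B) xs →
  sumMap f (concatMap g xs) ≡ sumMap (λ x → sumMap f (g x)) xs
sumMap-concatMap f g [] = refl
sumMap-concatMap f g (x ∷ xs) =
  trans (sumMap-++ f (g x) (concatMap g xs)) (cong (sumMap f (g x) +_) (sumMap-concatMap f g xs))

sumMap-↭ : ∀ {A : Set} (f : A → ℕ) {xs ys} → xs ↭ ys → sumMap f xs ≡ sumMap f ys
sumMap-↭ f ↭.refl = refl
sumMap-↭ f (↭.prep x p) = cong (f x +_) (sumMap-↭ f p)
sumMap-↭ f (↭.swap {xs = xs} x y p) = begin
  f x + (f y + sumMap f xs) ≡⟨ x∙yz≈y∙xz (f x) (f y) _ ⟩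
  f y + (f x + sumMap f xs) ≡⟨ cong (λ z → f y + (f x + z)) (sumMap-↭ f p) ⟩
  _                         ∎
  where open ≡-Reasoning
sumMap-↭ f (↭.trans p q) = trans (sumMap-↭ f p) (sumMap-↭ f q)

length-concatMap : ∀ {A B : Set} (g : A → List B) xs → length (concatMap g xs) ≡ sumMap (λ x → length (g x)) xs
length-concatMap g [] = refl
length-concatMap g (x ∷ xs) = trans (length-++ (g x)) (cong (length (g x) +_) (length-concatMap g xs))

All-concatMap : ∀ {A B : Set} {P : B → Set} (g : A → List B) xs → (∀ x → All P (g x)) → All P (concatMap g xs)
All-concatMap g [] h = []
All-concatMap g (x ∷ xs) h = ++⁺ (h x) (All-concatMap g xs h)

sumBelow : ℕ → (ℕ → ℕ) → ℕ
sumBelow zero h = 0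
sumBelow (suc n) h = h 0 + sumBelow n (λ j → h (suc j))

sumBelow-cong : ∀ n {h h' : ℕ → ℕ} → (∀ j → j < n → h j ≡ h' j) → sumBelow n h ≡ sumBelow n h'
sumBelow-cong zero e = refl
sumBelow-cong (suc n) e = cong₂ _+_ (e 0 (s≤s z≤n)) (sumBelow-cong n (λ j j< → e (suc j) (s≤s j<)))

sumBelow-mono : ∀ n {h h' : ℕ → ℕ} → (∀ j → j < n → h j ≤ h' j) → sumBelow n h ≤ sumBelow n h'
sumBelow-mono zero e = z≤n
sumBelow-mono (suc n) e = +-mono-≤ (e 0 (s≤s z≤n)) (sumBelow-mono n (λ j j< → e (suc j) (s≤s j<)))

sumBelow-+ : ∀ n (f g : ℕ → ℕ) → sumBelow n (λ j → f j + g j) ≡ sumBelow n f + sumBelow n g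
sumBelow-+ zero f g = refl
sumBelow-+ (suc n) f g =
  trans (cong (f 0 + g 0 +_) (sumBelow-+ n (λ j → f (suc j)) (λ j → g (suc j)))) (interchange (f 0) (g 0) _ _)

sumBelow-split : ∀ a n (h : ℕ → ℕ) → sumBelow (a + n) h ≡ sumBelow a h + sumBelow n (λ t → h (a + t))
sumBelow-split zero n h = refl
sumBelow-split (suc a) n h =
  trans (cong (h 0 +_) (sumBelow-split a n (λ j → h (suc j)))) (sym (+-assoc (h 0) _ _))

sumBelow-const : ∀ n c → sumBelow n (λ _ → c) ≡ n * c
sumBelow-const zero c = refl
sumBelow-const (suc n) c = cong (c +_) (sumBelow-const n c)

sumBelow-zero : ∀ n {h : ℕ → ℕ} → (∀ j → h j ≡ 0) → sumBelow n h ≡ 0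
sumBelow-zero n e = trans (sumBelow-cong n (λ j _ → e j)) (trans (sumBelow-const n 0) (*-zeroʳ n))

sumMap-applyUpTo : ∀ {A : Set} (f : A → ℕ) (g : ℕ → A) n → sumMap f (applyUpTo g n) ≡ sumBelow n (λ j → f (g j))
sumMap-applyUpTo f g zero = refl
sumMap-applyUpTo f g (suc n) = cong (f (g 0) +_) (sumMap-applyUpTo f (λ j → g (suc j)) n)

sumMap-tabulate : ∀ {A : Set} n (g : Fin n → A) (f : A → ℕ) (h : ℕ → ℕ) →
  (∀ i → f (g i) ≡ h (toℕ i)) → sumMap f (tabulate g) ≡ sumBelow n h
sumMap-tabulate zero g f h e = refl
sumMap-tabulate (suc n) g f h e =
  cong₂ _+_ (e Fin.zero) (sumMap-tabulate n (λ i → g (Fin.suc i)) f (λ j → h (suc j)) (λ i → e (Fin.suc i)))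

sumMap-allFin : ∀ n (f : Fin n → ℕ) (h : ℕ → ℕ) → (∀ i → f i ≡ h (toℕ i)) → sumMap f (allFin n) ≡ sumBelow n h
sumMap-allFin n f = sumMap-tabulate n (λ i → i) f

sumMap-allFin-const : ∀ n c → sumMap (λ (_ : Fin n) → c) (allFin n) ≡ n * c
sumMap-allFin-const n c = trans (sumMap-allFin n (λ _ → c) (λ _ → c) (λ _ → refl)) (sumBelow-const n c)

-- Degrees and vertex substitution

indicator : Bool → ℕ
indicator b = if b then 1 else 0

indicator≤1 : ∀ b → indicator b ≤ 1
indicator≤1 true = ≤-refl
indicator≤1 false = z≤n

≡ᵇ-refl : ∀ n → (n ≡ᵇ n) ≡ true
≡ᵇ-refl zero = refl
≡ᵇ-refl (suc n) = ≡ᵇ-refl n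

≢⇒≡ᵇ-false : ∀ m n → m ≢ n → (m ≡ᵇ n) ≡ false
≢⇒≡ᵇ-false zero zero ne = ⊥-elim (ne refl)
≢⇒≡ᵇ-false zero (suc n) ne = refl
≢⇒≡ᵇ-false (suc m) zero ne = refl
≢⇒≡ᵇ-false (suc m) (suc n) ne = ≢⇒≡ᵇ-false m n (λ e → ne (cong suc e))

≡ᵇ-true⇒≡ : ∀ m n → (m ≡ᵇ n) ≡ true → m ≡ n
≡ᵇ-true⇒≡ m n e = ≡ᵇ⇒≡ m n (subst T (sym e) tt)

≡ᵇ-false⇒≢ : ∀ m n → (m ≡ᵇ n) ≡ false → m ≢ n
≡ᵇ-false⇒≢ m n e refl with trans (sym e) (≡ᵇ-refl m)
... | ()

+-≡ᵇ-cancelˡ : ∀ b m n → (b + m ≡ᵇ b + n) ≡ (m ≡ᵇ n)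
+-≡ᵇ-cancelˡ zero m n = refl
+-≡ᵇ-cancelˡ (suc b) m n = +-≡ᵇ-cancelˡ b m n

decide≤ : ∀ {m n} → T (m ≤ᵇ n) → m ≤ n
decide≤ {m} {n} = ≤ᵇ⇒≤ m n

decide< : ∀ {m n} → T (m <ᵇ n) → m < n
decide< {m} {n} = <ᵇ⇒< m n

incidence : ℕ → ℕ × ℕ → ℕ
incidence w (x , y) = if x ≡ᵇ w then 1 else (if y ≡ᵇ w then 1 else 0)

occurrences : ℕ → List ℕ → ℕ
occurrences w = sumMap (λ u → indicator (u ≡ᵇ w))

edgeDegree : UGraph → ℕ → ℕ
edgeDegree g w = sumMap (incidence w) (edges g)

incidence≤ : ∀ w x y → incidence w (x , y) ≤ indicator (x ≡ᵇ w) + indicator (y ≡ᵇ w)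
incidence≤ w x y with x ≡ᵇ w | y ≡ᵇ w
... | true  | _     = s≤s z≤n
... | false | true  = s≤s z≤n
... | false | false = z≤n

incidence-miss : ∀ w x y → x ≢ w → y ≢ w → incidence w (x , y) ≡ 0
incidence-miss w x y x≢w y≢w rewrite ≢⇒≡ᵇ-false x w x≢w | ≢⇒≡ᵇ-false y w y≢w = refl

length-nbrs : ∀ n es w → length (nbrs (mkU n es) w) ≡ sumMap (incidence w) es
length-nbrs n [] w = refl
length-nbrs n ((x , y) ∷ es) w with x ≡ᵇ w | y ≡ᵇ w
... | true  | _     = cong suc (length-nbrs n es w)
... | false | true  = cong suc (length-nbrs n es w)
... | false | false = length-nbrs n es w

degree≡edgeDegree : ∀ g w → degree g w ≡ edgeDegree g w
degree≡edgeDegree g = length-nbrs (size g) (edges g)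

length-awayFrom : ∀ n es v → length (awayFrom (mkU n es) v) + sumMap (incidence v) es ≡ length es
length-awayFrom n [] v = refl
length-awayFrom n ((x , y) ∷ es) v with x ≡ᵇ v | y ≡ᵇ v
... | true  | _     = trans (+-suc _ _) (cong suc (length-awayFrom n es v))
... | false | true  = trans (+-suc _ _) (cong suc (length-awayFrom n es v))
... | false | false = cong suc (length-awayFrom n es v)

incidence-split : ∀ n es v u → u ≢ v →
  sumMap (incidence u) es ≡ sumMap (incidence u) (awayFrom (mkU n es) v) + occurrences u (nbrs (mkU n es) v)
incidence-split n [] v u u≢v = refl
incidence-split n ((x , y) ∷ es) v u u≢v with x ≡ᵇ v in x≡v | y ≡ᵇ v in y≡v
... | true | _ rewrite ≡ᵇ-true⇒≡ x v x≡v | ≢⇒≡ᵇ-false v u (≢-sym u≢v) with y ≡ᵇ u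
...   | true  = trans (cong suc (incidence-split n es v u u≢v)) (sym (+-suc _ _))
...   | false = incidence-split n es v u u≢v
incidence-split n ((x , y) ∷ es) v u u≢v | false | true
  rewrite ≡ᵇ-true⇒≡ y v y≡v | ≢⇒≡ᵇ-false v u (≢-sym u≢v) with x ≡ᵇ u
...   | true  = trans (cong suc (incidence-split n es v u u≢v)) (sym (+-suc _ _))
...   | false = incidence-split n es v u u≢v
incidence-split n ((x , y) ∷ es) v u u≢v | false | false =
  trans (cong (incidence u (x , y) +_) (incidence-split n es v u u≢v)) (sym (+-assoc (incidence u (x , y)) _ _))

-- After deleting v, the vertex now labelled w was labelled unrelabel v w.
unrelabel : ℕ → ℕ → ℕ
unrelabel zero w = suc w
unrelabel (suc v) zero = zero
unrelabel (suc v) (suc w) = suc (unrelabel v w)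

unrelabel≢ : ∀ v w → unrelabel v w ≢ v
unrelabel≢ zero w ()
unrelabel≢ (suc v) zero ()
unrelabel≢ (suc v) (suc w) e = unrelabel≢ v w (suc-injective e)

unrelabel-≥ : ∀ v w → v ≤ w → unrelabel v w ≡ suc w
unrelabel-≥ zero w _ = refl
unrelabel-≥ (suc v) (suc w) (s≤s v≤w) = cong suc (unrelabel-≥ v w v≤w)

sumBelow-unrelabel : ∀ v n (h : ℕ → ℕ) → v ≤ n → h v + sumBelow n (λ w → h (unrelabel v w)) ≡ sumBelow (suc n) h
sumBelow-unrelabel zero n h _ = refl
sumBelow-unrelabel (suc v) (suc n) h (s≤s v≤n) =
  trans (x∙yz≈y∙xz (h (suc v)) (h 0) _) (cong (h 0 +_) (sumBelow-unrelabel v n (λ j → h (suc j)) v≤n))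

relabel-suc : ∀ x v → x ≢ v → relabel (suc v) (suc x) ≡ suc (relabel v x)
relabel-suc zero zero x≢v = ⊥-elim (x≢v refl)
relabel-suc zero (suc v) x≢v = refl
relabel-suc (suc x) v x≢v with suc x <ᵇ v
... | true  = refl
... | false = refl

relabel-≡ᵇ : ∀ v x w → x ≢ v → (relabel v x ≡ᵇ w) ≡ (x ≡ᵇ unrelabel v w)
relabel-≡ᵇ zero zero w x≢v = ⊥-elim (x≢v refl)
relabel-≡ᵇ zero (suc x) w x≢v = refl
relabel-≡ᵇ (suc v) zero zero x≢v = refl
relabel-≡ᵇ (suc v) zero (suc w) x≢v = refl
relabel-≡ᵇ (suc v) (suc x) zero x≢v rewrite relabel-suc x v (x≢v ∘ cong suc) = refl
relabel-≡ᵇ (suc v) (suc x) (suc w) x≢v rewrite relabel-suc x v (x≢v ∘ cong suc) = relabel-≡ᵇ v x w (x≢v ∘ cong suc)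

relabel-< : ∀ b v x → x < suc b → x ≢ v → v < suc b → relabel v x < b
relabel-< b zero zero _ x≢v _ = ⊥-elim (x≢v refl)
relabel-< b zero (suc x) (s≤s x<) x≢v _ = x<
relabel-< (suc b) (suc v) zero _ x≢v _ = s≤s z≤n
relabel-< zero (suc v) x _ x≢v (s≤s ())
relabel-< (suc b) (suc v) (suc x) (s≤s x<) x≢v (s≤s v<) rewrite relabel-suc x v (x≢v ∘ cong suc) =
  s≤s (relabel-< b v x x< (x≢v ∘ cong suc) v<)

unrelabel-relabel : ∀ v x → x ≢ v → unrelabel v (relabel v x) ≡ x
unrelabel-relabel v x x≢v =
  sym (≡ᵇ-true⇒≡ x _ (trans (sym (relabel-≡ᵇ v x (relabel v x) x≢v)) (≡ᵇ-refl (relabel v x))))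

relabel-injective : ∀ v x y → x ≢ v → y ≢ v → x ≢ y → relabel v x ≢ relabel v y
relabel-injective v x y x≢v y≢v x≢y e =
  x≢y (trans (sym (unrelabel-relabel v x x≢v)) (trans (cong (unrelabel v) e) (unrelabel-relabel v y y≢v)))

ProperEdge : ℕ → ℕ × ℕ → Set
ProperEdge n (x , y) = x < n × y < n × x ≢ y

WellFormed : UGraph → Set
WellFormed g = All (ProperEdge (size g)) (edges g)

ProperEdgeAvoiding : ℕ → ℕ → ℕ × ℕ → Set
ProperEdgeAvoiding n v (x , y) = ProperEdge n (x , y) × x ≢ v × y ≢ v

OtherVertex : ℕ → ℕ → ℕ → Set
OtherVertex n v u = u < n × u ≢ v

awayFrom-avoiding : ∀ n m es v → All (ProperEdge m) es → All (ProperEdgeAvoiding m v) (awayFrom (mkU n es) v)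
awayFrom-avoiding n m [] v [] = []
awayFrom-avoiding n m ((x , y) ∷ es) v (p ∷ ps) with x ≡ᵇ v in x≡v | y ≡ᵇ v in y≡v
... | true  | _     = awayFrom-avoiding n m es v ps
... | false | true  = awayFrom-avoiding n m es v ps
... | false | false = (p , ≡ᵇ-false⇒≢ x v x≡v , ≡ᵇ-false⇒≢ y v y≡v) ∷ awayFrom-avoiding n m es v ps

awayFrom-proper : ∀ n m es v → All (ProperEdge m) es → All (ProperEdge m) (awayFrom (mkU n es) v)
awayFrom-proper n m es v ps = All.map proj₁ (awayFrom-avoiding n m es v ps)

nbrs-other : ∀ n m es v → All (ProperEdge m) es → All (OtherVertex m v) (nbrs (mkU n es) v)
nbrs-other n m [] v [] = []
nbrs-other n m ((x , y) ∷ es) v ((x< , y< , x≢y) ∷ ps) with x ≡ᵇ v in x≡v | y ≡ᵇ v in y≡v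
... | true  | _     = (y< , λ y≡v → x≢y (trans (≡ᵇ-true⇒≡ x v x≡v) (sym y≡v))) ∷ nbrs-other n m es v ps
... | false | true  = (x< , ≡ᵇ-false⇒≢ x v x≡v) ∷ nbrs-other n m es v ps
... | false | false = nbrs-other n m es v ps

incidence-beyond : ∀ m w es → All (ProperEdge m) es → m ≤ w → sumMap (incidence w) es ≡ 0
incidence-beyond m w [] [] _ = refl
incidence-beyond m w ((x , y) ∷ es) ((x< , y< , _) ∷ ps) m≤w
  rewrite incidence-miss w x y (<⇒≢ (≤-trans x< m≤w)) (<⇒≢ (≤-trans y< m≤w)) = incidence-beyond m w es ps m≤w

-- The edge maps of substitute are pattern lambdas, so the next lemmas take them as
-- arguments characterised pointwise.

incidence-relabelled : ∀ n es v w (φ : ℕ × ℕ → ℕ × ℕ) → (∀ x y → φ (x , y) ≡ (relabel v x , relabel v y)) →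
  sumMap (incidence w) (map φ (awayFrom (mkU n es) v)) ≡ sumMap (incidence (unrelabel v w)) (awayFrom (mkU n es) v)
incidence-relabelled n [] v w φ φ≗ = refl
incidence-relabelled n ((x , y) ∷ es) v w φ φ≗ with x ≡ᵇ v in x≡v | y ≡ᵇ v in y≡v
... | true  | _    = incidence-relabelled n es v w φ φ≗
... | false | true = incidence-relabelled n es v w φ φ≗
... | false | false
  rewrite φ≗ x y | relabel-≡ᵇ v x w (≡ᵇ-false⇒≢ x v x≡v) | relabel-≡ᵇ v y w (≡ᵇ-false⇒≢ y v y≡v) =
  cong (incidence (unrelabel v w) (x , y) +_) (incidence-relabelled n es v w φ φ≗)

incidence-shifted-below : ∀ b w (σ : ℕ × ℕ → ℕ × ℕ) → (∀ x y → σ (x , y) ≡ (b + x , b + y)) → w < b →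
  ∀ es → sumMap (incidence w) (map σ es) ≡ 0
incidence-shifted-below b w σ σ≗ w<b [] = refl
incidence-shifted-below b w σ σ≗ w<b ((x , y) ∷ es)
  rewrite σ≗ x y | incidence-miss w (b + x) (b + y) (≢-sym (<⇒≢ (≤-trans w<b (m≤m+n b x))))
                                                    (≢-sym (<⇒≢ (≤-trans w<b (m≤m+n b y)))) =
  incidence-shifted-below b w σ σ≗ w<b es

incidence-shifted : ∀ b i (σ : ℕ × ℕ → ℕ × ℕ) → (∀ x y → σ (x , y) ≡ (b + x , b + y)) →
  ∀ es → sumMap (incidence (b + i)) (map σ es) ≡ sumMap (incidence i) es
incidence-shifted b i σ σ≗ [] = refl
incidence-shifted b i σ σ≗ ((x , y) ∷ es) rewrite σ≗ x y | +-≡ᵇ-cancelˡ b x i | +-≡ᵇ-cancelˡ b y i =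
  cong (incidence i (x , y) +_) (incidence-shifted b i σ σ≗ es)

incidence-joins-old : ∀ b v w (ψ : ℕ → ℕ → ℕ × ℕ) → (∀ u a → ψ u a ≡ (relabel v u , b + a)) → w < b →
  ∀ us as → All (OtherVertex (suc b) v) us → length as ≡ length us →
  sumMap (incidence w) (zipWith ψ us as) ≡ occurrences (unrelabel v w) us
incidence-joins-old b v w ψ ψ≗ w<b [] [] _ _ = refl
incidence-joins-old b v w ψ ψ≗ w<b (u ∷ us) (a ∷ as) ((_ , u≢v) ∷ ok) len
  rewrite ψ≗ u a | relabel-≡ᵇ v u w u≢v | ≢⇒≡ᵇ-false (b + a) w (≢-sym (<⇒≢ (≤-trans w<b (m≤m+n b a))))
  with u ≡ᵇ unrelabel v w
... | true  = cong suc (incidence-joins-old b v w ψ ψ≗ w<b us as ok (suc-injective len))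
... | false = incidence-joins-old b v w ψ ψ≗ w<b us as ok (suc-injective len)

incidence-joins-new : ∀ b v i (ψ : ℕ → ℕ → ℕ × ℕ) → (∀ u a → ψ u a ≡ (relabel v u , b + a)) → v < suc b →
  ∀ us as → All (OtherVertex (suc b) v) us → length as ≡ length us →
  sumMap (incidence (b + i)) (zipWith ψ us as) ≡ occurrences i as
incidence-joins-new b v i ψ ψ≗ v< [] [] _ _ = refl
incidence-joins-new b v i ψ ψ≗ v< (u ∷ us) (a ∷ as) ((u< , u≢v) ∷ ok) len
  rewrite ψ≗ u a | ≢⇒≡ᵇ-false (relabel v u) (b + i) (<⇒≢ (≤-trans (relabel-< b v u u< u≢v v<) (m≤m+n b i)))
        | +-≡ᵇ-cancelˡ b a i
  with a ≡ᵇ i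
... | true  = cong suc (incidence-joins-new b v i ψ ψ≗ v< us as ok (suc-injective len))
... | false = incidence-joins-new b v i ψ ψ≗ v< us as ok (suc-injective len)

degreeSum : (ℕ → ℕ) → UGraph → ℕ
degreeSum F g = sumBelow (size g) (λ w → F (edgeDegree g w))

module Substitution (b : ℕ) (es : List (ℕ × ℕ)) (v k : ℕ) (gE : List (ℕ × ℕ)) (att : List ℕ)
                    (wf : WellFormed (mkU (suc b) es)) (v< : v < suc b)
                    (att-length : length att ≡ length (nbrs (mkU (suc b) es) v)) where

  private
    g h : UGraph
    g = mkU (suc b) es
    h = substitute g v k gE att
    nb : List ℕ
    nb = nbrs g v
    aw : List (ℕ × ℕ)
    aw = awayFrom g v
    nb-other : All (OtherVertex (suc b) v) nb
    nb-other = nbrs-other (suc b) (suc b) es v wf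

  edgeDegree-old : ∀ w → w < b → edgeDegree h w ≡ edgeDegree g (unrelabel v w)
  edgeDegree-old w w<b = begin
    edgeDegree h w
      ≡⟨ sumMap-++ (incidence w) (map _ aw) _ ⟩
    sumMap (incidence w) (map _ aw) + sumMap (incidence w) (map _ gE ++ zipWith _ nb att)
      ≡⟨ cong (sumMap (incidence w) (map _ aw) +_) (sumMap-++ (incidence w) (map _ gE) _) ⟩
    sumMap (incidence w) (map _ aw) + (sumMap (incidence w) (map _ gE) + sumMap (incidence w) (zipWith _ nb att))
      ≡⟨ cong₂ _+_ (incidence-relabelled (suc b) es v w _ (λ _ _ → refl))
                   (cong₂ _+_ (incidence-shifted-below b w _ (λ _ _ → refl) w<b gE)
                              (incidence-joins-old b v w _ (λ _ _ → refl) w<b nb att nb-other att-length)) ⟩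
    sumMap (incidence (unrelabel v w)) aw + occurrences (unrelabel v w) nb
      ≡⟨ incidence-split (suc b) es v (unrelabel v w) (unrelabel≢ v w) ⟨
    edgeDegree g (unrelabel v w) ∎
    where open ≡-Reasoning

  edgeDegree-new : ∀ i → edgeDegree h (b + i) ≡ sumMap (incidence i) gE + occurrences i att
  edgeDegree-new i = begin
    edgeDegree h (b + i)
      ≡⟨ sumMap-++ (incidence (b + i)) (map _ aw) _ ⟩
    sumMap (incidence (b + i)) (map _ aw) + sumMap (incidence (b + i)) (map _ gE ++ zipWith _ nb att)
      ≡⟨ cong (sumMap (incidence (b + i)) (map _ aw) +_) (sumMap-++ (incidence (b + i)) (map _ gE) _) ⟩
    sumMap (incidence (b + i)) (map _ aw) + (sumMap (incidence (b + i)) (map _ gE) + sumMap (incidence (b + i)) (zipWith _ nb att))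
      ≡⟨ cong₂ _+_ (trans (incidence-relabelled (suc b) es v (b + i) _ (λ _ _ → refl))
                          (incidence-beyond (suc b) (unrelabel v (b + i)) aw
                             (awayFrom-proper (suc b) (suc b) es v wf) old-vertex-beyond))
                   (cong₂ _+_ (incidence-shifted b i _ (λ _ _ → refl) gE)
                              (incidence-joins-new b v i _ (λ _ _ → refl) v< nb att nb-other att-length)) ⟩
    sumMap (incidence i) gE + occurrences i att ∎
    where
    open ≡-Reasoning
    old-vertex-beyond : suc b ≤ unrelabel v (b + i)
    old-vertex-beyond = ≤-trans (s≤s (m≤m+n b i))
                                (≤-reflexive (sym (unrelabel-≥ v (b + i) (≤-trans (≤-pred v<) (m≤m+n b i)))))

  degreeSum-substitute : ∀ F → degreeSum F h + F (edgeDegree g v)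
                                ≡ degreeSum F g + sumBelow k (λ i → F (sumMap (incidence i) gE + occurrences i att))
  degreeSum-substitute F = begin
    degreeSum F h + F (edgeDegree g v)
      ≡⟨ cong (_+ F (edgeDegree g v)) (sumBelow-split b k (λ w → F (edgeDegree h w))) ⟩
    (sumBelow b (λ w → F (edgeDegree h w)) + sumBelow k (λ i → F (edgeDegree h (b + i)))) + F (edgeDegree g v)
      ≡⟨ cong (_+ F (edgeDegree g v)) (cong₂ _+_ (sumBelow-cong b (λ w w<b → cong F (edgeDegree-old w w<b)))
                                                 (sumBelow-cong k (λ i _ → cong F (edgeDegree-new i)))) ⟩
    (sumBelow b (λ w → F (edgeDegree g (unrelabel v w))) + new) + F (edgeDegree g v)
      ≡⟨ [a+c]+d≡[d+a]+c (sumBelow b (λ w → F (edgeDegree g (unrelabel v w)))) new (F (edgeDegree g v)) ⟩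
    (F (edgeDegree g v) + sumBelow b (λ w → F (edgeDegree g (unrelabel v w)))) + new
      ≡⟨ cong (_+ new) (sumBelow-unrelabel v b (λ w → F (edgeDegree g w)) (≤-pred v<)) ⟩
    degreeSum F g + new ∎
    where
    open ≡-Reasoning
    new : ℕ
    new = sumBelow k (λ i → F (sumMap (incidence i) gE + occurrences i att))
    [a+c]+d≡[d+a]+c : ∀ a c d → (a + c) + d ≡ (d + a) + c
    [a+c]+d≡[d+a]+c = solve 3 (λ a c d → (a :+ c) :+ d := (d :+ a) :+ c) refl

  numEdges-substitute : numEdges h ≡ numEdges g + length gE
  numEdges-substitute = begin
    length (map _ aw ++ map _ gE ++ zipWith _ nb att)
      ≡⟨ length-++ (map _ aw) ⟩
    length (map _ aw) + length (map _ gE ++ zipWith _ nb att)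
      ≡⟨ cong₂ _+_ (length-map _ aw) (length-++ (map _ gE)) ⟩
    length aw + (length (map _ gE) + length (zipWith _ nb att))
      ≡⟨ cong (λ z → length aw + z) (cong₂ _+_ (length-map _ gE) (length-zipWith _ nb att)) ⟩
    length aw + (length gE + (length nb ⊓ length att))
      ≡⟨ cong (λ z → length aw + (length gE + z)) (trans (cong (length nb ⊓_) att-length) (⊓-idem (length nb))) ⟩
    length aw + (length gE + length nb)
      ≡⟨ cong (λ z → length aw + (length gE + z)) (length-nbrs (suc b) es v) ⟩
    length aw + (length gE + sumMap (incidence v) es)
      ≡⟨ a+[c+d]≡[a+d]+c (length aw) (length gE) _ ⟩
    (length aw + sumMap (incidence v) es) + length gE
      ≡⟨ cong (_+ length gE) (length-awayFrom (suc b) es v) ⟩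
    length es + length gE ∎
    where
    open ≡-Reasoning
    a+[c+d]≡[a+d]+c : ∀ a c d → a + (c + d) ≡ (a + d) + c
    a+[c+d]≡[a+d]+c = solve 3 (λ a c d → a :+ (c :+ d) := (a :+ d) :+ c) refl

  wellFormed-substitute : All (ProperEdge k) gE → All (_< k) att → WellFormed h
  wellFormed-substitute gE-proper att-bounded = ++⁺ old-edges (++⁺ gadget-edges joining-edges)
    where
    old-edges : All (ProperEdge (b + k)) (map _ aw)
    old-edges = go aw (awayFrom-avoiding (suc b) (suc b) es v wf)
      where
      go : ∀ xs → All (ProperEdgeAvoiding (suc b) v) xs →
           All (ProperEdge (b + k)) (map (λ { (x , y) → relabel v x , relabel v y }) xs)
      go [] [] = []
      go ((x , y) ∷ xs) (((x< , y< , x≢y) , x≢v , y≢v) ∷ ps) =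
        (≤-trans (relabel-< b v x x< x≢v v<) (m≤m+n b k) ,
         ≤-trans (relabel-< b v y y< y≢v v<) (m≤m+n b k) ,
         relabel-injective v x y x≢v y≢v x≢y) ∷ go xs ps
    gadget-edges : All (ProperEdge (b + k)) (map _ gE)
    gadget-edges = go gE gE-proper
      where
      go : ∀ xs → All (ProperEdge k) xs → All (ProperEdge (b + k)) (map (λ { (x , y) → b + x , b + y }) xs)
      go [] [] = []
      go ((x , y) ∷ xs) ((x< , y< , x≢y) ∷ ps) =
        (+-monoʳ-< b x< , +-monoʳ-< b y< , x≢y ∘ +-cancelˡ-≡ b x y) ∷ go xs ps
    joining-edges : All (ProperEdge (b + k)) (zipWith _ nb att)
    joining-edges = go nb att nb-other att-bounded
      where
      go : ∀ us as → All (OtherVertex (suc b) v) us → All (_< k) as →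
           All (ProperEdge (b + k)) (zipWith (λ u a → relabel v u , b + a) us as)
      go [] _ _ _ = []
      go (u ∷ us) [] _ _ = []
      go (u ∷ us) (a ∷ as) ((u< , u≢v) ∷ ok) (a< ∷ as<) =
        (≤-trans (relabel-< b v u u< u≢v v<) (m≤m+n b k) , +-monoʳ-< b a< ,
         <⇒≢ (≤-trans (relabel-< b v u u< u≢v v<) (m≤m+n b a))) ∷ go us as ok as<

-- The cost of a graph

-- A gate on a vertex of degree 4 + r adds 2r + 10 vertices and 3r + 14 edges, and its
-- new vertices cost at most vertexCost (3 + r) + 8 (2r + 2) (one vertex of degree 3 + r,
-- the others of degree at most 3); 40 + 21 r + vertexCost (3 + r) pays for all of it.
-- A diamond adds 3 vertices and 5 edges, paid by vertexCost 2 = 8.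
vertexCost highDegreeCost : ℕ → ℕ
vertexCost 0 = 0
vertexCost 1 = 0
vertexCost 2 = 8
vertexCost 3 = 0
vertexCost (suc (suc (suc (suc r)))) = highDegreeCost r
highDegreeCost zero = 40
highDegreeCost (suc r) = 40 + 21 * suc r + highDegreeCost r

highDegreeCost-unfold : ∀ r → highDegreeCost r ≡ 40 + 21 * r + vertexCost (3 + r)
highDegreeCost-unfold zero = refl
highDegreeCost-unfold (suc r) = refl

highDegreeCost-mono : ∀ {r e} → r ≤ e → highDegreeCost r ≤ highDegreeCost e
highDegreeCost-mono {zero} {zero} _ = ≤-refl
highDegreeCost-mono {zero} {suc e} _ = ≤-trans (highDegreeCost-mono {zero} {e} z≤n) (m≤n+m (highDegreeCost e) _)
highDegreeCost-mono {suc r} {suc e} (s≤s r≤e) =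
  +-mono-≤ (+-monoʳ-≤ 40 (*-monoʳ-≤ 21 (s≤s r≤e))) (highDegreeCost-mono r≤e)

vertexCost-≤3 : ∀ n → n ≤ 3 → vertexCost n ≤ 8
vertexCost-≤3 0 _ = z≤n
vertexCost-≤3 1 _ = z≤n
vertexCost-≤3 2 _ = ≤-refl
vertexCost-≤3 3 _ = z≤n
vertexCost-≤3 (suc (suc (suc (suc n)))) (s≤s (s≤s (s≤s ())))

vertexCost-≤4+ : ∀ n e → n ≤ 4 + e → vertexCost n ≤ 8 + highDegreeCost e
vertexCost-≤4+ 0 e _ = z≤n
vertexCost-≤4+ 1 e _ = z≤n
vertexCost-≤4+ 2 e _ = m≤m+n 8 (highDegreeCost e)
vertexCost-≤4+ 3 e _ = z≤n
vertexCost-≤4+ (suc (suc (suc (suc n)))) e (s≤s (s≤s (s≤s (s≤s n≤e)))) =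
  ≤-trans (highDegreeCost-mono n≤e) (m≤n+m (highDegreeCost e) 8)

cost : UGraph → ℕ
cost g = size g + numEdges g + degreeSum vertexCost g

-- Gates

double : ℕ → ℕ
double zero = zero
double (suc n) = suc (suc (double n))

2*≡double : ∀ n → 2 * n ≡ double n
2*≡double zero = refl
2*≡double (suc n) = trans (cong suc (+-suc n (n + 0))) (cong (suc ∘ suc) (2*≡double n))

gateM≡ : ∀ r → gateM (4 + r) ≡ suc (double r)
gateM≡ r = cong (_∸ 7) (2*≡double (4 + r))

-- gateEdges s with its number 2s - 7 of b-vertices abstracted, which does not compute for s = 4 + r
gateEdgesWith : ℕ → ℕ → List (ℕ × ℕ)
gateEdgesWith s m =
  (0 , 2) ∷ (0 , 7) ∷ (1 , 2) ∷ (1 , 4) ∷ (2 , 3) ∷ (3 , 4) ∷ (3 , 5) ∷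
  (5 , 6) ∷ (6 , 7) ∷ (6 , 9) ∷ (7 , 8) ∷ (8 , 9) ∷
  (4 , gateB 1) ∷ (9 , gateB m) ∷ []
  ++ applyUpTo (λ i → gateB (suc i) , gateB (suc (suc i))) (m ∸ 1)
  ++ applyUpTo (λ j → 0 , gateB (2 * suc j)) (s ∸ 4)

module _ (r : ℕ) where

  edgesOfGate : List (ℕ × ℕ)
  edgesOfGate = gateEdgesWith (4 + r) (suc (double r))

  chain spokes : List (ℕ × ℕ)
  chain = applyUpTo (λ i → gateB (suc i) , gateB (suc (suc i))) (double r)
  spokes = applyUpTo (λ j → 0 , gateB (2 * suc j)) r

  oddBs : List ℕ
  oddBs = applyUpTo (λ i → gateB (suc (2 * i))) (suc r)

  gateDegree : ℕ → ℕ
  gateDegree i = sumMap (incidence i) edgesOfGate + occurrences i (gateAttach (4 + r))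

  chain-spokes-miss-core : ∀ i → 1 ≤ i → i ≤ 9 → sumMap (incidence i) (chain ++ spokes) ≡ 0
  chain-spokes-miss-core i 1≤i i≤9 = trans (sumMap-++ (incidence i) chain spokes)
    (cong₂ _+_ (trans (sumMap-applyUpTo (incidence i) _ (double r))
                      (sumBelow-zero (double r) (λ j → incidence-miss i (10 + j) (11 + j)
                         (≢-sym (<⇒≢ (s≤s (≤-trans i≤9 (m≤m+n 9 j)))))
                         (≢-sym (<⇒≢ (s≤s (≤-trans i≤9 (≤-trans (m≤m+n 9 j) (n≤1+n _)))))))))
               (trans (sumMap-applyUpTo (incidence i) _ r)
                      (sumBelow-zero r (λ j → incidence-miss i 0 (9 + 2 * suc j) (<⇒≢ 1≤i)
                         (≢-sym (<⇒≢ (≤-trans (s≤s i≤9) (+-monoʳ-≤ 9 (s≤s z≤n)))))))))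

  oddBs-miss-core : ∀ i → i ≤ 9 → occurrences i oddBs ≡ 0
  oddBs-miss-core i i≤9 = trans (sumMap-applyUpTo (λ u → indicator (u ≡ᵇ i)) (λ j → gateB (suc (2 * j))) (suc r))
    (sumBelow-zero (suc r) (λ j → cong indicator (≢⇒≡ᵇ-false (9 + suc (2 * j)) i
                                    (≢-sym (<⇒≢ (s≤s (≤-trans i≤9 (m≤m+n 9 _))))))))

  gateDegree-core : ∀ i m a → 1 ≤ i → i ≤ 9 →
    gateDegree i ≡ m + sumMap (incidence i) (chain ++ spokes) + (a + occurrences i oddBs) →
    gateDegree i ≡ m + 0 + (a + 0)
  gateDegree-core i m a 1≤i i≤9 e =
    trans e (cong₂ (λ x y → m + x + (a + y)) (chain-spokes-miss-core i 1≤i i≤9) (oddBs-miss-core i i≤9))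

  gateDegree-hub : gateDegree 0 ≡ 3 + r
  gateDegree-hub = begin
    gateDegree 0
      ≡⟨⟩
    2 + sumMap (incidence 0) (chain ++ spokes) + (1 + occurrences 0 oddBs)
      ≡⟨ cong₂ (λ x y → 2 + x + (1 + y)) spokes-at-hub (oddBs-miss-core 0 z≤n) ⟩
    2 + r + (1 + 0)
      ≡⟨ solve 1 (λ r → con 2 :+ r :+ (con 1 :+ con 0) := con 3 :+ r) refl r ⟩
    3 + r ∎
    where
    open ≡-Reasoning
    spokes-at-hub : sumMap (incidence 0) (chain ++ spokes) ≡ r
    spokes-at-hub = trans (sumMap-++ (incidence 0) chain spokes)
      (cong₂ _+_ (trans (sumMap-applyUpTo (incidence 0) _ (double r)) (sumBelow-zero (double r) (λ _ → refl)))
                 (trans (sumMap-applyUpTo (incidence 0) _ r) (trans (sumBelow-const r 1) (*-identityʳ r))))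

  coreCost : ℕ → ℕ
  coreCost 0 = vertexCost (3 + r)
  coreCost 5 = 8
  coreCost _ = 0

  vertexCost-core : ∀ j → j < 10 → vertexCost (gateDegree j) ≡ coreCost j
  vertexCost-core 0 _ = cong vertexCost gateDegree-hub
  vertexCost-core 1 _ = cong vertexCost (gateDegree-core 1 2 1 (decide≤ tt) (decide≤ tt) refl)
  vertexCost-core 2 _ = cong vertexCost (gateDegree-core 2 3 0 (decide≤ tt) (decide≤ tt) refl)
  vertexCost-core 3 _ = cong vertexCost (gateDegree-core 3 3 0 (decide≤ tt) (decide≤ tt) refl)
  vertexCost-core 4 _ = cong vertexCost (gateDegree-core 4 3 0 (decide≤ tt) (decide≤ tt) refl)
  vertexCost-core 5 _ = cong vertexCost (gateDegree-core 5 2 0 (decide≤ tt) (decide≤ tt) refl)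
  vertexCost-core 6 _ = cong vertexCost (gateDegree-core 6 3 0 (decide≤ tt) (decide≤ tt) refl)
  vertexCost-core 7 _ = cong vertexCost (gateDegree-core 7 3 0 (decide≤ tt) (decide≤ tt) refl)
  vertexCost-core 8 _ = cong vertexCost (gateDegree-core 8 2 1 (decide≤ tt) (decide≤ tt) refl)
  vertexCost-core 9 _ = cong vertexCost (gateDegree-core 9 3 0 (decide≤ tt) (decide≤ tt) refl)
  vertexCost-core (suc (suc (suc (suc (suc (suc (suc (suc (suc (suc j)))))))))) (s≤s (s≤s (s≤s (s≤s (s≤s (s≤s (s≤s (s≤s (s≤s (s≤s ()))))))))))

  coreCost-sum : sumBelow 10 (λ i → vertexCost (gateDegree i)) ≡ vertexCost (3 + r) + 8
  coreCost-sum = sumBelow-cong 10 vertexCost-core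

sumBelow-≡ᵇ-≤1 : ∀ n t → sumBelow n (λ j → indicator (j ≡ᵇ t)) + indicator (n ≡ᵇ t) ≤ 1
sumBelow-≡ᵇ-≤1 zero t = indicator≤1 (0 ≡ᵇ t)
sumBelow-≡ᵇ-≤1 (suc n) zero = ≤-reflexive (cong (λ a → suc a + 0) (sumBelow-zero n (λ _ → refl)))
sumBelow-≡ᵇ-≤1 (suc n) (suc t) = sumBelow-≡ᵇ-≤1 n t

sumBelow-suc-≡ᵇ-≤1 : ∀ n t → sumBelow n (λ j → indicator (suc j ≡ᵇ t)) + indicator (0 ≡ᵇ t) ≤ 1
sumBelow-suc-≡ᵇ-≤1 n zero = ≤-reflexive (cong (_+ 1) (sumBelow-zero n (λ _ → refl)))
sumBelow-suc-≡ᵇ-≤1 n (suc t) =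
  ≤-trans (≤-reflexive (+-identityʳ _)) (≤-trans (m≤m+n _ (indicator (n ≡ᵇ t))) (sumBelow-≡ᵇ-≤1 n t))

sumBelow-odd-even-≡ᵇ-≤1 : ∀ r t →
  sumBelow r (λ j → indicator (suc (double j) ≡ᵇ t)) + sumBelow (suc r) (λ j → indicator (double j ≡ᵇ t)) ≤ 1
sumBelow-odd-even-≡ᵇ-≤1 zero t = ≤-trans (≤-reflexive (+-identityʳ _)) (indicator≤1 (0 ≡ᵇ t))
sumBelow-odd-even-≡ᵇ-≤1 (suc r) zero =
  ≤-reflexive (cong₂ (λ a b → a + (1 + b)) (sumBelow-zero r (λ _ → refl)) (sumBelow-zero (suc r) (λ _ → refl)))
sumBelow-odd-even-≡ᵇ-≤1 (suc r) (suc zero) =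
  ≤-reflexive (cong₂ (λ a b → (1 + a) + b) (sumBelow-zero r (λ _ → refl)) (sumBelow-zero (suc r) (λ _ → refl)))
sumBelow-odd-even-≡ᵇ-≤1 (suc r) (suc (suc t)) = sumBelow-odd-even-≡ᵇ-≤1 r t

-- b_(t+1) has its two neighbours on the path b_1 … b_(2r+1) (gate vertices 5 and 10 at the
-- ends), and in addition vertex 1 if t is odd or a former neighbour of the gated vertex if t is even.
gateDegree-b≤3 : ∀ r t → gateDegree r (10 + t) ≤ 3
gateDegree-b≤3 r t = begin
  gateDegree r (10 + t)
    ≡⟨⟩
  indicator (0 ≡ᵇ t) + (indicator (D ≡ᵇ t) + sumMap (incidence (10 + t)) (chain r ++ spokes r))
    + occurrences (10 + t) (oddBs r)
    ≡⟨ cong₂ (λ a b → indicator (0 ≡ᵇ t) + (indicator (D ≡ᵇ t) + a) + b)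
         (trans (sumMap-++ (incidence (10 + t)) (chain r) (spokes r))
                (cong₂ _+_ (sumMap-applyUpTo (incidence (10 + t)) _ D)
                           (trans (sumMap-applyUpTo (incidence (10 + t)) _ r)
                                  (sumBelow-cong r (λ j _ → cong (λ z → indicator (z ≡ᵇ suc t)) (2*≡double (suc j)))))))
         (trans (sumMap-applyUpTo (λ u → indicator (u ≡ᵇ (10 + t))) (λ j → gateB (suc (2 * j))) (suc r))
                (sumBelow-cong (suc r) (λ j _ → cong (λ z → indicator (z ≡ᵇ t)) (2*≡double j)))) ⟩
  indicator (0 ≡ᵇ t) + (indicator (D ≡ᵇ t) + (onPath + odd)) + even
    ≤⟨ +-monoˡ-≤ even (+-monoʳ-≤ (indicator (0 ≡ᵇ t)) (+-monoʳ-≤ (indicator (D ≡ᵇ t)) (+-monoˡ-≤ odd path≤))) ⟩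
  indicator (0 ≡ᵇ t) + (indicator (D ≡ᵇ t) + ((left + right) + odd)) + even
    ≡⟨ solve 6 (λ a b c d e f → a :+ (b :+ ((c :+ d) :+ e)) :+ f := (c :+ b) :+ (d :+ a) :+ (e :+ f)) refl
         (indicator (0 ≡ᵇ t)) (indicator (D ≡ᵇ t)) left right odd even ⟩
  (left + indicator (D ≡ᵇ t)) + (right + indicator (0 ≡ᵇ t)) + (odd + even)
    ≤⟨ +-mono-≤ (+-mono-≤ (sumBelow-≡ᵇ-≤1 D t) (sumBelow-suc-≡ᵇ-≤1 D t)) (sumBelow-odd-even-≡ᵇ-≤1 r t) ⟩
  3 ∎
  where
  open ≤-Reasoning
  D onPath left right odd even : ℕ
  D = double r
  onPath = sumBelow D (λ j → incidence (10 + t) (10 + j , 11 + j))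
  left   = sumBelow D (λ j → indicator (j ≡ᵇ t))
  right  = sumBelow D (λ j → indicator (suc j ≡ᵇ t))
  odd    = sumBelow r (λ j → indicator (suc (double j) ≡ᵇ t))
  even   = sumBelow (suc r) (λ j → indicator (double j ≡ᵇ t))
  path≤ : onPath ≤ left + right
  path≤ = ≤-trans (sumBelow-mono D (λ j _ → incidence≤ (10 + t) (10 + j) (11 + j))) (≤-reflexive (sumBelow-+ D _ _))

properEdge-by-decide : ∀ {n} x y → {T (x <ᵇ n)} → {T (y <ᵇ n)} → x ≢ y → ProperEdge n (x , y)
properEdge-by-decide x y {x<n} {y<n} x≢y = decide< x<n , decide< y<n , x≢y

edgesOfGate-proper : ∀ r → All (ProperEdge (10 + suc (double r))) (edgesOfGate r)
edgesOfGate-proper r =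
  e 0 2 (λ ()) ∷ e 0 7 (λ ()) ∷ e 1 2 (λ ()) ∷ e 1 4 (λ ()) ∷ e 2 3 (λ ()) ∷ e 3 4 (λ ()) ∷ e 3 5 (λ ()) ∷
  e 5 6 (λ ()) ∷ e 6 7 (λ ()) ∷ e 6 9 (λ ()) ∷ e 7 8 (λ ()) ∷ e 8 9 (λ ()) ∷ e 4 10 (λ ()) ∷
  (decide< tt , ≤-refl , (λ ())) ∷
  ++⁺ (applyUpTo⁺₁ _ (double r) (λ {j} j< →
         let q = +-monoʳ-≤ 11 j< in ≤-trans (n≤1+n _) q , q , <⇒≢ (n<1+n (10 + j))))
      (applyUpTo⁺₁ _ r (λ {j} j< →
         s≤s z≤n ,
         +-monoʳ-≤ 10 (≤-trans (*-monoʳ-≤ 2 j<) (≤-trans (≤-reflexive (2*≡double r)) (n≤1+n (double r)))) ,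
         (λ ())))
  where
  e : ∀ x y → {T (x <ᵇ 10 + suc (double r))} → {T (y <ᵇ 10 + suc (double r))} → x ≢ y →
      ProperEdge (10 + suc (double r)) (x , y)
  e = properEdge-by-decide

gateAttach-bounded : ∀ r → All (_< 10 + suc (double r)) (gateAttach (4 + r))
gateAttach-bounded r = decide< tt ∷ decide< tt ∷ decide< tt ∷
  applyUpTo⁺₁ _ (suc r) (λ j< → +-monoʳ-≤ 11 (≤-trans (*-monoʳ-≤ 2 (≤-pred j<)) (≤-reflexive (2*≡double r))))

module Gate (r : ℕ) (att : List ℕ) (att↭ : att ↭ gateAttach (4 + r)) where

  private
    s D : ℕ
    s = 4 + r
    D = double r

  gateSize≡ : gateSize s ≡ 10 + suc D
  gateSize≡ = cong (10 +_) (gateM≡ r)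

  gateEdges≡ : gateEdges s ≡ edgesOfGate r
  gateEdges≡ = cong (gateEdgesWith s) (gateM≡ r)

  gateEdges-proper : All (ProperEdge (gateSize s)) (gateEdges s)
  gateEdges-proper = subst₂ (λ n l → All (ProperEdge n) l) (sym gateSize≡) (sym gateEdges≡) (edgesOfGate-proper r)

  att-bounded : All (_< gateSize s) att
  att-bounded = All-resp-↭ (↭.↭-sym att↭) (subst (λ n → All (_< n) (gateAttach s)) (sym gateSize≡) (gateAttach-bounded r))

  length-att : length att ≡ s
  length-att = trans (↭-length att↭) (cong (3 +_) (length-applyUpTo (λ i → gateB (suc (2 * i))) (suc r)))

  length-gateEdges : length (gateEdges s) ≡ 14 + (D + r)
  length-gateEdges = trans (cong length gateEdges≡)
    (cong (14 +_) (trans (length-++ (chain r))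
                         (cong₂ _+_ (length-applyUpTo (λ i → gateB (suc i) , gateB (suc (suc i))) D)
                                    (length-applyUpTo (λ j → 0 , gateB (2 * suc j)) r))))

  gateCost≤ : sumBelow (gateSize s) (λ i → vertexCost (sumMap (incidence i) (gateEdges s) + occurrences i att))
              ≤ vertexCost (3 + r) + 8 + suc D * 8
  gateCost≤ = begin
    sumBelow (gateSize s) (λ i → vertexCost (sumMap (incidence i) (gateEdges s) + occurrences i att))
      ≡⟨ cong₂ (λ n l → sumBelow n (λ i → vertexCost (sumMap (incidence i) l + occurrences i att))) gateSize≡ gateEdges≡ ⟩
    sumBelow (10 + suc D) (λ i → vertexCost (sumMap (incidence i) (edgesOfGate r) + occurrences i att))
      ≡⟨ sumBelow-cong (10 + suc D) (λ i _ → cong (λ z → vertexCost (sumMap (incidence i) (edgesOfGate r) + z))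
                                                   (sumMap-↭ (λ u → indicator (u ≡ᵇ i)) att↭)) ⟩
    sumBelow (10 + suc D) (λ i → vertexCost (gateDegree r i))
      ≡⟨ sumBelow-split 10 (suc D) (λ i → vertexCost (gateDegree r i)) ⟩
    sumBelow 10 (λ i → vertexCost (gateDegree r i)) + sumBelow (suc D) (λ t → vertexCost (gateDegree r (10 + t)))
      ≤⟨ +-mono-≤ (≤-reflexive (coreCost-sum r)) (sumBelow-mono (suc D) (λ t _ → vertexCost-≤3 _ (gateDegree-b≤3 r t))) ⟩
    vertexCost (3 + r) + 8 + sumBelow (suc D) (λ _ → 8)
      ≡⟨ cong (vertexCost (3 + r) + 8 +_) (sumBelow-const (suc D) 8) ⟩
    vertexCost (3 + r) + 8 + suc D * 8 ∎
    where open ≤-Reasoning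

-- Steps (2) and (3) do not raise the cost

Cheaper : UGraph → UGraph → Set
Cheaper h g = WellFormed h × cost h ≤ cost g

gateReplace-cheaper-4+ : ∀ b es v r att → WellFormed (mkU (suc b) es) → v < suc b →
  degree (mkU (suc b) es) v ≡ 4 + r → att ↭ gateAttach (4 + r) →
  Cheaper (substitute (mkU (suc b) es) v (gateSize (4 + r)) (gateEdges (4 + r)) att) (mkU (suc b) es)
gateReplace-cheaper-4+ b es v r att wf v< deg att↭ =
  wellFormed-substitute gateEdges-proper att-bounded , +-cancelʳ-≤ (highDegreeCost r) _ _ cost≤
  where
  open Gate r att att↭
  g : UGraph
  g = mkU (suc b) es
  k : ℕ
  k = gateSize (4 + r)
  gE : List (ℕ × ℕ)
  gE = gateEdges (4 + r)
  open Substitution b es v k gE att wf v< (trans length-att (sym deg))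
  h : UGraph
  h = substitute g v k gE att
  edgeDegree-v : edgeDegree g v ≡ 4 + r
  edgeDegree-v = trans (sym (degree≡edgeDegree g v)) deg
  E Φ D : ℕ
  E = length es
  Φ = degreeSum vertexCost g
  D = double r
  cost≤ : cost h + highDegreeCost r ≤ cost g + highDegreeCost r
  cost≤ = begin
    (b + k) + numEdges h + degreeSum vertexCost h + highDegreeCost r
      ≡⟨ cong₂ (λ m c → (b + k) + m + degreeSum vertexCost h + c) numEdges-substitute (sym (cong vertexCost edgeDegree-v)) ⟩
    (b + k) + (E + length gE) + degreeSum vertexCost h + vertexCost (edgeDegree g v)
      ≡⟨ +-assoc ((b + k) + (E + length gE)) (degreeSum vertexCost h) _ ⟩
    (b + k) + (E + length gE) + (degreeSum vertexCost h + vertexCost (edgeDegree g v))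
      ≡⟨ cong ((b + k) + (E + length gE) +_) (degreeSum-substitute vertexCost) ⟩
    (b + k) + (E + length gE) + (Φ + sumBelow k (λ i → vertexCost (sumMap (incidence i) gE + occurrences i att)))
      ≤⟨ +-monoʳ-≤ ((b + k) + (E + length gE)) (+-monoʳ-≤ Φ gateCost≤) ⟩
    (b + k) + (E + length gE) + (Φ + (vertexCost (3 + r) + 8 + suc D * 8))
      ≡⟨ cong₂ (λ x y → (b + x) + (E + y) + (Φ + (vertexCost (3 + r) + 8 + suc D * 8))) gateSize≡ length-gateEdges ⟩
    (b + (10 + suc D)) + (E + (14 + (D + r))) + (Φ + (vertexCost (3 + r) + 8 + suc D * 8))
      ≡⟨ cong (λ d → (b + (10 + suc d)) + (E + (14 + (d + r))) + (Φ + (vertexCost (3 + r) + 8 + suc d * 8)))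
              (sym (2*≡double r)) ⟩
    (b + (10 + suc (2 * r))) + (E + (14 + (2 * r + r))) + (Φ + (vertexCost (3 + r) + 8 + suc (2 * r) * 8))
      ≡⟨ solve 5 (λ b E r F p →
            (b :+ (con 10 :+ (con 1 :+ con 2 :* r))) :+ (E :+ (con 14 :+ (con 2 :* r :+ r)))
              :+ (F :+ (p :+ con 8 :+ (con 1 :+ con 2 :* r) :* con 8))
            := (con 1 :+ b :+ E) :+ F :+ (con 40 :+ con 21 :* r :+ p)) refl b E r Φ (vertexCost (3 + r)) ⟩
    (suc b + E) + Φ + (40 + 21 * r + vertexCost (3 + r))
      ≡⟨ cong ((suc b + E) + Φ +_) (sym (highDegreeCost-unfold r)) ⟩
    cost g + highDegreeCost r ∎
    where open ≤-Reasoning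

gateReplace-cheaper : ∀ b es v s att → WellFormed (mkU (suc b) es) → v < suc b →
  degree (mkU (suc b) es) v ≡ s → 4 ≤ s → att ↭ gateAttach s →
  Cheaper (substitute (mkU (suc b) es) v (gateSize s) (gateEdges s) att) (mkU (suc b) es)
gateReplace-cheaper b es v s att wf v< deg 4≤s att↭ with m≤n⇒∃[o]m+o≡n 4≤s
... | r , refl = gateReplace-cheaper-4+ b es v r att wf v< deg att↭

diamondEdges : List (ℕ × ℕ)
diamondEdges = (0 , 1) ∷ (0 , 2) ∷ (1 , 2) ∷ (1 , 3) ∷ (2 , 3) ∷ []

diamond-cheaper : ∀ b es v → WellFormed (mkU (suc b) es) → v < suc b → degree (mkU (suc b) es) v ≡ 2 →
  Cheaper (diamond (mkU (suc b) es) v) (mkU (suc b) es)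
diamond-cheaper b es v wf v< deg =
  wellFormed-substitute diamondEdges-proper (decide< tt ∷ decide< tt ∷ []) , +-cancelʳ-≤ 8 _ _ (≤-reflexive cost≡)
  where
  g : UGraph
  g = mkU (suc b) es
  open Substitution b es v 4 diamondEdges (0 ∷ 3 ∷ []) wf v< (sym deg)
  h : UGraph
  h = diamond g v
  E : ℕ
  E = length es
  diamondEdges-proper : All (ProperEdge 4) diamondEdges
  diamondEdges-proper =
    properEdge-by-decide 0 1 (λ ()) ∷ properEdge-by-decide 0 2 (λ ()) ∷ properEdge-by-decide 1 2 (λ ()) ∷
    properEdge-by-decide 1 3 (λ ()) ∷ properEdge-by-decide 2 3 (λ ()) ∷ []
  edgeDegree-v : edgeDegree g v ≡ 2
  edgeDegree-v = trans (sym (degree≡edgeDegree g v)) deg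
  cost≡ : cost h + 8 ≡ cost g + 8
  cost≡ = begin
    (b + 4) + numEdges h + degreeSum vertexCost h + 8
      ≡⟨ cong₂ (λ m c → (b + 4) + m + degreeSum vertexCost h + c) numEdges-substitute (sym (cong vertexCost edgeDegree-v)) ⟩
    (b + 4) + (E + 5) + degreeSum vertexCost h + vertexCost (edgeDegree g v)
      ≡⟨ +-assoc ((b + 4) + (E + 5)) (degreeSum vertexCost h) _ ⟩
    (b + 4) + (E + 5) + (degreeSum vertexCost h + vertexCost (edgeDegree g v))
      ≡⟨ cong ((b + 4) + (E + 5) +_) (degreeSum-substitute vertexCost) ⟩
    (b + 4) + (E + 5) + (degreeSum vertexCost g + 0)
      ≡⟨ solve 3 (λ b E F → (b :+ con 4) :+ (E :+ con 5) :+ (F :+ con 0) := (con 1 :+ b :+ E) :+ F :+ con 8)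
               refl b E (degreeSum vertexCost g) ⟩
    cost g + 8 ∎
    where open ≡-Reasoning

Cheaper-trans : ∀ {f g h} → Cheaper f g → Cheaper g h → Cheaper f h
Cheaper-trans (wf , f≤g) (_ , g≤h) = wf , ≤-trans f≤g g≤h

gated-cheaper : ∀ {g h} → WellFormed g → Gated g h → Cheaper h g
gated-cheaper wf (gdone _) = wf , ≤-refl
gated-cheaper {mkU zero es} wf (gstep v () _ _ _ _)
gated-cheaper {mkU (suc b) es} {h} wf (gstep v v< 4≤ att att↭ rest) =
  Cheaper-trans {h} {gateReplace (mkU (suc b) es) v att} {mkU (suc b) es} (gated-cheaper (proj₁ step) rest) step
  where
  step : Cheaper (gateReplace (mkU (suc b) es) v att) (mkU (suc b) es)
  step = gateReplace-cheaper b es v _ att wf v< refl 4≤ att↭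

diamonds-cheaper : ∀ {g h} → WellFormed g → Diamonds g h → cost h ≤ cost g
diamonds-cheaper wf (ddone _) = ≤-refl
diamonds-cheaper {mkU zero es} wf (dstep v () _ _)
diamonds-cheaper {mkU (suc b) es} wf (dstep v v< deg rest) =
  let step = diamond-cheaper b es v wf v< deg in ≤-trans (diamonds-cheaper (proj₁ step) rest) (proj₂ step)

cubify-cheaper : ∀ {g h} → WellFormed g → Cubify g h → (h ≡ petersen × 0 < size g) ⊎ cost h ≤ cost g
cubify-cheaper wf (toPetersen v v< _) = inj₁ (refl , ≤-trans (s≤s z≤n) v<)
cubify-cheaper wf (toDiamonds _ ds) = inj₂ (diamonds-cheaper wf ds)

-- The graph of step (1)

cV≢aV : ∀ u v → cV u ≢ aV v
cV≢aV zero zero ()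
cV≢aV zero (suc v) e with trans e (*-suc 3 v)
... | ()
cV≢aV (suc u) zero ()
cV≢aV (suc u) (suc v) e =
  cV≢aV u v (+-cancelˡ-≡ 3 _ _ (trans (cong (_+ 2) (sym (*-suc 3 u))) (trans e (*-suc 3 v))))

3*+<3* : ∀ {v N} c → v < N → c < 3 → 3 * v + c < 3 * N
3*+<3* {v} c v<N c<3 = ≤-trans (+-monoʳ-< (3 * v) c<3)
  (≤-trans (≤-reflexive (trans (+-comm (3 * v) 3) (sym (*-suc 3 v)))) (*-monoʳ-≤ 3 v<N))

aV< : ∀ {N} (v : Fin N) → aV (toℕ v) < 3 * N
aV< {N} v = subst (_< 3 * N) (+-identityʳ _) (3*+<3* 0 (toℕ<n v) (s≤s z≤n))
bV< : ∀ {N} (v : Fin N) → bV (toℕ v) < 3 * N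
bV< v = 3*+<3* 1 (toℕ<n v) (s≤s (s≤s z≤n))
cV< : ∀ {N} (v : Fin N) → cV (toℕ v) < 3 * N
cV< v = 3*+<3* 2 (toℕ<n v) (s≤s (s≤s (s≤s z≤n)))

3*+-strictMono : ∀ c a b → a < b → 3 * a + c < 3 * b + c
3*+-strictMono c a b a<b = +-monoˡ-< c (*-monoʳ-< 3 a<b)

length-if : ∀ {A : Set} b (x : A) → length (if b then x ∷ [] else []) ≡ indicator b
length-if true x = refl
length-if false x = refl

count≡sumMap : ∀ {N} (p : Fin N → Bool) → count p ≡ sumMap (λ u → indicator (p u)) (allFin N)
count≡sumMap {N} p = trans (length-concatMap _ (allFin N)) (sumMap-cong (allFin N) (λ u → length-if (p u) u))

sumBelow-strictMono-≤1 : ∀ n (φ : ℕ → ℕ) w → (∀ a b → a < b → φ a < φ b) → sumBelow n (λ j → indicator (φ j ≡ᵇ w)) ≤ 1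
sumBelow-strictMono-≤1 zero φ w mono = z≤n
sumBelow-strictMono-≤1 (suc n) φ w mono with φ 0 ≡ᵇ w in φ0≡w
... | true  = ≤-reflexive (cong suc (sumBelow-zero n (λ j → cong indicator (≢⇒≡ᵇ-false (φ (suc j)) w
                 (λ e → <⇒≢ (subst (_< φ (suc j)) (≡ᵇ-true⇒≡ (φ 0) w φ0≡w) (mono 0 (suc j) (s≤s z≤n))) (sym e))))))
... | false = sumBelow-strictMono-≤1 n (φ ∘ suc) w (λ a b a<b → mono (suc a) (suc b) (s≤s a<b))

sumMap-allFin-strictMono-≤1 : ∀ N (φ : ℕ → ℕ) w → (∀ a b → a < b → φ a < φ b) →
  sumMap (λ v → indicator (φ (toℕ v) ≡ᵇ w)) (allFin N) ≤ 1
sumMap-allFin-strictMono-≤1 N φ w mono =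
  ≤-trans (≤-reflexive (sumMap-allFin N _ (λ j → indicator (φ j ≡ᵇ w)) (λ _ → refl))) (sumBelow-strictMono-≤1 N φ w mono)

module InitialGraph {N} (G : Digraph N) (d : ℕ)
                    (indeg≤ : ∀ (v : Fin N) → indeg G v ≤ d) (outdeg≤ : ∀ (v : Fin N) → outdeg G v ≤ d) where

  private
    vertices : List (Fin N)
    vertices = allFin N
    path : Fin N → List (ℕ × ℕ)
    path v = (aV (toℕ v) , bV (toℕ v)) ∷ (bV (toℕ v) , cV (toℕ v)) ∷ []
    arc : Fin N → Fin N → List (ℕ × ℕ)
    arc u v = if G u v then (cV (toℕ u) , aV (toℕ v)) ∷ [] else []
    pathEdges arcEdges : List (ℕ × ℕ)
    pathEdges = concatMap path vertices
    arcEdges = concatMap (λ u → concatMap (arc u) vertices) vertices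

  dirToUndir-wellFormed : WellFormed (dirToUndir G)
  dirToUndir-wellFormed =
    ++⁺ (All-concatMap path vertices (λ v →
           (aV< v , bV< v , <⇒≢ (m<m+n (3 * toℕ v) (s≤s z≤n))) ∷
           (bV< v , cV< v , <⇒≢ (+-monoʳ-< (3 * toℕ v) (s≤s (s≤s z≤n)))) ∷ []))
        (All-concatMap (λ u → concatMap (arc u) vertices) vertices (λ u →
           All-concatMap (arc u) vertices (λ v → arc-proper u v (G u v))))
    where
    arc-proper : ∀ u v b → All (ProperEdge (3 * N)) (if b then (cV (toℕ u) , aV (toℕ v)) ∷ [] else [])
    arc-proper u v true = (cV< u , aV< v , cV≢aV (toℕ u) (toℕ v)) ∷ []
    arc-proper u v false = []

  outdeg≡ : ∀ u → sumMap (λ v → indicator (G u v)) vertices ≡ outdeg G u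
  outdeg≡ u = sym (count≡sumMap (G u))

  indeg≡ : ∀ v → sumMap (λ u → indicator (G u v)) vertices ≡ indeg G v
  indeg≡ v = sym (count≡sumMap (λ u → G u v))

  numEdges≤ : numEdges (dirToUndir G) ≤ N * 2 + N * d
  numEdges≤ = begin
    length (pathEdges ++ arcEdges)
      ≡⟨ length-++ pathEdges ⟩
    length pathEdges + length arcEdges
      ≡⟨ cong₂ _+_ (trans (length-concatMap path vertices) (sumMap-allFin-const N 2))
                   (trans (length-concatMap _ vertices)
                      (sumMap-cong vertices (λ u → trans (length-concatMap (arc u) vertices)
                         (trans (sumMap-cong vertices (λ v → length-if (G u v) _)) (outdeg≡ u))))) ⟩
    N * 2 + sumMap (outdeg G) vertices
      ≤⟨ +-monoʳ-≤ (N * 2) (≤-trans (sumMap-mono vertices outdeg≤) (≤-reflexive (sumMap-allFin-const N d))) ⟩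
    N * 2 + N * d ∎
    where open ≤-Reasoning

  pathEdges-degree≤ : ∀ w → sumMap (incidence w) pathEdges ≤ 4
  pathEdges-degree≤ w = begin
    sumMap (incidence w) pathEdges
      ≡⟨ sumMap-concatMap (incidence w) path vertices ⟩
    sumMap (λ v → incidence w (aV (toℕ v) , bV (toℕ v)) + (incidence w (bV (toℕ v) , cV (toℕ v)) + 0)) vertices
      ≤⟨ sumMap-mono vertices (λ v → +-mono-≤ (incidence≤ w (aV (toℕ v)) (bV (toℕ v)))
                                             (≤-trans (≤-reflexive (+-identityʳ _)) (incidence≤ w (bV (toℕ v)) (cV (toℕ v))))) ⟩
    sumMap (λ v → (atA v + atB v) + (atB v + atC v)) vertices
      ≡⟨ trans (sumMap-+ (λ v → atA v + atB v) (λ v → atB v + atC v) vertices)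
               (cong₂ _+_ (sumMap-+ atA atB vertices) (sumMap-+ atB atC vertices)) ⟩
    (sumMap atA vertices + sumMap atB vertices) + (sumMap atB vertices + sumMap atC vertices)
      ≤⟨ +-mono-≤ (+-mono-≤ (unique (λ j → 3 * j) (λ a b → *-monoʳ-< 3)) (unique bV (3*+-strictMono 1)))
                  (+-mono-≤ (unique bV (3*+-strictMono 1)) (unique cV (3*+-strictMono 2))) ⟩
    4 ∎
    where
    open ≤-Reasoning
    atA atB atC : Fin N → ℕ
    atA v = indicator (aV (toℕ v) ≡ᵇ w)
    atB v = indicator (bV (toℕ v) ≡ᵇ w)
    atC v = indicator (cV (toℕ v) ≡ᵇ w)
    unique : ∀ φ → (∀ a b → a < b → φ a < φ b) → sumMap (λ v → indicator (φ (toℕ v) ≡ᵇ w)) vertices ≤ 1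
    unique φ = sumMap-allFin-strictMono-≤1 N φ w

  arcEdges-degree≤ : ∀ w → sumMap (incidence w) arcEdges ≤ d + d
  arcEdges-degree≤ w = begin
    sumMap (incidence w) arcEdges
      ≡⟨ trans (sumMap-concatMap (incidence w) _ vertices)
               (sumMap-cong vertices (λ u → sumMap-concatMap (incidence w) (arc u) vertices)) ⟩
    sumMap (λ u → sumMap (λ v → sumMap (incidence w) (arc u v)) vertices) vertices
      ≤⟨ sumMap-mono vertices (λ u → sumMap-mono vertices (λ v → arc-incidence≤ u v (G u v))) ⟩
    sumMap (λ u → sumMap (λ v → atC u * indicator (G u v) + atA v * indicator (G u v)) vertices) vertices
      ≡⟨ trans (sumMap-cong vertices (λ u → sumMap-+ (λ v → atC u * indicator (G u v)) (λ v → atA v * indicator (G u v)) vertices))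
               (sumMap-+ (λ u → sumMap (λ v → atC u * indicator (G u v)) vertices)
                         (λ u → sumMap (λ v → atA v * indicator (G u v)) vertices) vertices) ⟩
    sumMap (λ u → sumMap (λ v → atC u * indicator (G u v)) vertices) vertices
      + sumMap (λ u → sumMap (λ v → atA v * indicator (G u v)) vertices) vertices
      ≡⟨ cong₂ _+_ (sumMap-cong vertices (λ u → trans (sumMap-*ˡ (atC u) (λ v → indicator (G u v)) vertices)
                                                      (cong (atC u *_) (outdeg≡ u))))
                   (trans (sumMap-comm (λ u v → atA v * indicator (G u v)) vertices vertices)
                          (sumMap-cong vertices (λ v → trans (sumMap-*ˡ (atA v) (λ u → indicator (G u v)) vertices)
                                                            (cong (atA v *_) (indeg≡ v))))) ⟩
    sumMap (λ u → atC u * outdeg G u) vertices + sumMap (λ v → atA v * indeg G v) vertices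
      ≤⟨ +-mono-≤ (sumMap-mono vertices (λ u → *-monoʳ-≤ (atC u) (outdeg≤ u)))
                  (sumMap-mono vertices (λ v → *-monoʳ-≤ (atA v) (indeg≤ v))) ⟩
    sumMap (λ u → atC u * d) vertices + sumMap (λ v → atA v * d) vertices
      ≡⟨ cong₂ _+_ (sumMap-*ʳ d atC vertices) (sumMap-*ʳ d atA vertices) ⟩
    sumMap atC vertices * d + sumMap atA vertices * d
      ≤⟨ +-mono-≤ (≤-trans (*-monoˡ-≤ d (sumMap-allFin-strictMono-≤1 N cV w (3*+-strictMono 2))) (≤-reflexive (*-identityˡ d)))
                  (≤-trans (*-monoˡ-≤ d (sumMap-allFin-strictMono-≤1 N (λ j → 3 * j) w (λ a b → *-monoʳ-< 3)))
                           (≤-reflexive (*-identityˡ d))) ⟩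
    d + d ∎
    where
    open ≤-Reasoning
    atA atC : Fin N → ℕ
    atA v = indicator (aV (toℕ v) ≡ᵇ w)
    atC u = indicator (cV (toℕ u) ≡ᵇ w)
    arc-incidence≤ : ∀ u v b → sumMap (incidence w) (if b then (cV (toℕ u) , aV (toℕ v)) ∷ [] else [])
                                 ≤ atC u * indicator b + atA v * indicator b
    arc-incidence≤ u v true = ≤-trans (≤-reflexive (+-identityʳ _))
      (≤-trans (incidence≤ w (cV (toℕ u)) (aV (toℕ v))) (≤-reflexive (sym (cong₂ _+_ (*-identityʳ (atC u)) (*-identityʳ (atA v))))))
    arc-incidence≤ u v false = z≤n

  edgeDegree≤ : ∀ w → edgeDegree (dirToUndir G) w ≤ 4 + (d + d)
  edgeDegree≤ w = ≤-trans (≤-reflexive (sumMap-++ (incidence w) pathEdges arcEdges))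
                          (+-mono-≤ (pathEdges-degree≤ w) (arcEdges-degree≤ w))

costBound : ℕ → ℕ
costBound d = 5 + d + 3 * (8 + highDegreeCost (d + d))

dirToUndir-cost≤ : ∀ {N} (G : Digraph N) d → (∀ v → indeg G v ≤ d) → (∀ v → outdeg G v ≤ d) →
  cost (dirToUndir G) ≤ costBound d * N
dirToUndir-cost≤ {N} G d indeg≤ outdeg≤ = begin
  3 * N + numEdges (dirToUndir G) + sumBelow (3 * N) (λ w → vertexCost (edgeDegree (dirToUndir G) w))
    ≤⟨ +-mono-≤ (+-monoʳ-≤ (3 * N) numEdges≤)
                (sumBelow-mono (3 * N) (λ w _ → vertexCost-≤4+ _ (d + d) (edgeDegree≤ w))) ⟩
  3 * N + (N * 2 + N * d) + sumBelow (3 * N) (λ _ → 8 + highDegreeCost (d + d))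
    ≡⟨ cong (3 * N + (N * 2 + N * d) +_) (sumBelow-const (3 * N) (8 + highDegreeCost (d + d))) ⟩
  3 * N + (N * 2 + N * d) + 3 * N * (8 + highDegreeCost (d + d))
    ≡⟨ solve 3 (λ N d q → con 3 :* N :+ (N :* con 2 :+ N :* d) :+ con 3 :* N :* (con 8 :+ q)
                 := (con 5 :+ d :+ con 3 :* (con 8 :+ q)) :* N) refl N d (highDegreeCost (d + d)) ⟩
  costBound d * N ∎
  where
  open ≤-Reasoning
  open InitialGraph G d indeg≤ outdeg≤

cost-bounds : ∀ K N H → cost H ≤ K * N → size H ≤ (K + 15) * N × numEdges H ≤ (K + 15) * N
cost-bounds K N H H≤ = ≤-trans (m≤m+n (size H) _) bound , ≤-trans (m≤n+m (numEdges H) (size H)) bound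
  where
  bound : size H + numEdges H ≤ (K + 15) * N
  bound = ≤-trans (m≤m+n _ (degreeSum vertexCost H)) (≤-trans H≤ (*-monoˡ-≤ N (m≤m+n K 15)))

petersen-bounds : ∀ K N → 0 < K * N → size petersen ≤ (K + 15) * N × numEdges petersen ≤ (K + 15) * N
petersen-bounds K zero 0<K*0 = ⊥-elim (<-irrefl (sym (*-zeroʳ K)) 0<K*0)
petersen-bounds K (suc N) _ = ≤-trans (m≤n+m 10 5) bound , bound
  where
  bound : 15 ≤ (K + 15) * suc N
  bound = ≤-trans (m≤n+m 15 K) (m≤m*n (K + 15) (suc N))

converts-cost≤ : ∀ {N} (G : Digraph N) d → (∀ v → indeg G v ≤ d) → (∀ v → outdeg G v ≤ d) →
  ∀ {H} → Converts G H → (H ≡ petersen × 0 < costBound d * N) ⊎ cost H ≤ costBound d * N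
converts-cost≤ {N} G d indeg≤ outdeg≤ (g , gating , cubifying) =
  Sum.map (map₂ (λ 0<size → ≤-trans 0<size (≤-trans (m≤m+n _ _) (≤-trans (m≤m+n _ _) g≤))))
          (λ H≤g → ≤-trans H≤g g≤)
          (cubify-cheaper (proj₁ gated) cubifying)
  where
  gated : Cheaper g (dirToUndir G)
  gated = gated-cheaper (InitialGraph.dirToUndir-wellFormed G d indeg≤ outdeg≤) gating
  g≤ : cost g ≤ costBound d * N
  g≤ = ≤-trans (proj₂ gated) (dirToUndir-cost≤ G d indeg≤ outdeg≤)

corollary4p6 : (d : ℕ) → 1 ≤ d →
    ∃[ C ] (∀ (N : ℕ) (G : Digraph N) → Loopless G →
      (∀ (v : Fin N) → indeg G v ≤ d) → (∀ (v : Fin N) → outdeg G v ≤ d) →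
      ∀ (H : UGraph) → Converts G H →
      size H ≤ C * N × numEdges H ≤ C * N)
corollary4p6 d _ = costBound d + 15 , λ N G _ indeg≤ outdeg≤ H conv →
  case converts-cost≤ G d indeg≤ outdeg≤ conv of λ where
    (inj₁ (refl , 0<K*N)) → petersen-bounds (costBound d) N 0<K*N
    (inj₂ H≤K*N) → cost-bounds (costBound d) N H H≤K*N
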